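{- The sets $S_1$ and $S_{ -1}$ are singleton sets.
   Context: For $u\in\mathbb{Z}[x]$ of degree at least $1$, define iterates $u^{(1)}=u$ and $u^{(n+1)}(x)=u(u^{(n)}(x))$. For $r\in\mathbb{Z}$, $L_{r,\emptyset}$ is the set of $u\in\mathbb{Z}[x]$ of degree at least $1$ such that for every prime $p$ there exists $m\ge1$ with $u^{(m)}(r)\equiv 0\pmod p$; $N_r$ is the set of $u\in\mathbb{Z}[x]$ of degree at least $1$ with $u^{(n)}(r)=0$ for some $n\ge1$; and $S_r:=L_{r,\emptyset}\setminus N_r$. -}

module Defs where

open import Data.Nat using (ℕ; zero; suc; _≥_)
open import Data.Nat.Primality using (Prime)
open import Data.Integer using (ℤ; +_; _+_; _*_; 0ℤ)
open import Data.Integer.Divisibility using (_∣_)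
open import Data.List using (List; []; _∷_)
open import Data.Product using (Σ; ∃; ∃-syntax; _×_)
open import Relation.Binary.PropositionalEquality using (_≡_; _≢_)
open import Relation.Nullary using (¬_)

-- A polynomial in ℤ[x], represented by its list of coefficients
-- [a₀, a₁, …, a_d] (lowest degree first), meaning a₀ + a₁x + … + a_d x^d.
-- Trailing zeros are allowed; polynomial equality is coefficientwise (_≈ₚ_).
Poly : Set
Poly = List ℤ

coeff : Poly → ℕ → ℤ
coeff []       _       = 0ℤ
coeff (a ∷ _)  zero    = a
coeff (_ ∷ as) (suc i) = coeff as i

_≈ₚ_ : Poly → Poly → Set
u ≈ₚ v = ∀ i → coeff u i ≡ coeff v i

DegGe1 : Poly → Set
DegGe1 u = ∃[ i ] (i ≥ 1 × coeff u i ≢ 0ℤ)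

eval : Poly → ℤ → ℤ
eval []       x = 0ℤ
eval (a ∷ as) x = a + x * eval as x

iter : Poly → ℕ → ℤ → ℤ
iter u zero    r = r
iter u (suc n) r = eval u (iter u n r)

L : ℤ → Poly → Set
L r u = DegGe1 u × (∀ p → Prime p → ∃[ m ] (m ≥ 1 × (+ p) ∣ iter u m r))

N : ℤ → Poly → Set
N r u = DegGe1 u × ∃[ n ] (n ≥ 1 × iter u n r ≡ 0ℤ)

S : ℤ → Poly → Set
S r u = L r u × ¬ N r u

IsSingleton : (Poly → Set) → Set
IsSingleton P = ∃[ u ] (P u × (∀ v → P v → v ≈ₚ u))

-- For u ∈ S₁ put aₙ = u⁽ⁿ⁾(1). Since x − y ∣ u(x) − u(y), a congruence
-- a_{k+1} ≡ a_j (mod d) with j ≤ k makes the orbit periodic mod d from j on, so a prime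
-- dividing some aₙ already divides one of a₀, …, a_k. We show aₙ = n + 1 by induction.
-- If a₀, …, a_k = 1, …, k+1 then c = a_{k+1} is nonzero, c ≡ k + 2 (mod m) for 0 < m ≤ k,
-- and every prime factor of c − (j+1), j ≤ k, is at most k + 1. A value c ∈ {1, …, k+1}
-- would thus bound all primes. Otherwise the prime factors of c − (k+1) and of c − 1 are
-- all forced to equal k + 1, which then divides their difference k: impossible.
-- So u(x) = x + 1 at all positive integers, hence as a polynomial; r = −1 reduces to
-- r = 1 through x ↦ −u(−x).

module Submission where

open import Defs
open import Data.Integer using (+_; -[1+_])
open import Data.Product using (_×_)

open import Data.Nat as ℕ using (ℕ; zero; suc; _≤_; _<_; s≤s; s≤s⁻¹; z≤n; _!)
import Data.Nat.Properties as ℕP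
import Data.Nat.Divisibility as ℕD
open import Data.Nat.Primality using (Prime; ¬prime[0]; ¬prime[1]; prime⇒nonZero; prime⇒irreducible)
open import Data.Nat.Primality.Factorisation using (factorise)
open import Data.Integer using (ℤ; _+_; _*_; _-_; -_; ∣_∣; 0ℤ; 1ℤ)
import Data.Integer.Properties as ℤP
open import Data.Integer.Divisibility.Signed using (_∣_; divides; ∣ᵤ⇒∣; ∣⇒∣ᵤ; ∣-trans; ∣m∣n⇒∣m+n; ∣m∣n⇒∣m-n; ∣m⇒∣-m)
import Data.Integer.Divisibility as Unsigned
open import Data.Integer.Tactic.RingSolver using (solve-∀)
open import Data.List using ([]; _∷_)
open import Data.Nat.ListAction using (product)
open import Data.List.Relation.Unary.All using (_∷_)
open import Data.Product using (∃-syntax; _,_)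
open import Data.Sum using (inj₁; inj₂)
open import Data.Empty using (⊥; ⊥-elim)
open import Relation.Nullary using (¬_)
open import Relation.Binary.PropositionalEquality
open import Relation.Binary.Definitions using (tri<; tri≈; tri>)

prime-factor : ∀ {n} → 2 ≤ n → ∃[ p ] (Prime p × p ℕD.∣ n)
prime-factor {suc zero} (s≤s ())
prime-factor {suc (suc n)} _ with factorise (suc (suc n))
... | record { factors = [] ; isFactorisation = () }
... | record { factors = p ∷ ps ; isFactorisation = eq ; factorsPrime = p-prime ∷ _ } =
  p , p-prime , ℕD.divides (product ps) (trans eq (ℕP.*-comm p _))

prime-factorℤ : ∀ {z} → 2 ≤ ∣ z ∣ → ∃[ p ] (Prime p × + p ∣ z)
prime-factorℤ 2≤∣z∣ with prime-factor 2≤∣z∣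
... | p , p-prime , p∣z = p , p-prime , ∣ᵤ⇒∣ p∣z

prime∤1 : ∀ {p} → Prime p → ¬ (+ p ∣ 1ℤ)
prime∤1 p-prime p∣1 with ℕD.∣1⇒≡1 (∣⇒∣ᵤ p∣1)
... | refl = ¬prime[1] p-prime

m≤n⇒m∣n! : ∀ {m n} → 0 < m → m ≤ n → m ℕD.∣ n !
m≤n⇒m∣n! {suc m} _ m≤n = ℕD.∣-trans (ℕD.m∣m*n (m !)) (ℕD.m≤n⇒m!∣n! m≤n)

prime> : ∀ n → ∃[ p ] (Prime p × n < p)
prime> n with prime-factor (s≤s (ℕP.1≤n! n))
... | p , p-prime , p∣n!+1 with ℕP.≤-<-connex p n
...   | inj₂ n<p = p , p-prime , n<p
...   | inj₁ p≤n = ⊥-elim (¬prime[1] (subst Prime (ℕD.∣1⇒≡1 p∣1) p-prime))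
  where
  p∣1 : p ℕD.∣ 1
  p∣1 = ℕD.∣m+n∣m⇒∣n (subst (p ℕD.∣_) (ℕP.+-comm 1 (n !)) p∣n!+1)
          (m≤n⇒m∣n! (ℕ.>-nonZero⁻¹ p {{prime⇒nonZero p-prime}}) p≤n)

StepCongruent : (ℕ → ℤ) → Set
StepCongruent a = ∀ m n → (a m - a n) ∣ (a (suc m) - a (suc n))

eval-respects-∣ : ∀ u x y → (x - y) ∣ (eval u x - eval u y)
eval-respects-∣ [] x y = divides 0ℤ (sym (ℤP.*-zeroˡ (x - y)))
eval-respects-∣ (c ∷ u) x y with eval-respects-∣ u x y
... | divides q eq = divides (x * q + eval u y) (begin
  (c + x * eval u x) - (c + y * eval u y)        ≡⟨ split c x y (eval u x) (eval u y) ⟩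
  x * (eval u x - eval u y) + (x - y) * eval u y ≡⟨ cong (λ e → x * e + (x - y) * eval u y) eq ⟩
  x * (q * (x - y)) + (x - y) * eval u y         ≡⟨ collect x y q (eval u y) ⟩
  (x * q + eval u y) * (x - y)                   ∎)
  where
  open ≡-Reasoning
  split : ∀ c x y ex ey → (c + x * ex) - (c + y * ey) ≡ x * (ex - ey) + (x - y) * ey
  split = solve-∀
  collect : ∀ x y q ey → x * (q * (x - y)) + (x - y) * ey ≡ (x * q + ey) * (x - y)
  collect = solve-∀

iter-stepCongruent : ∀ u r → StepCongruent (λ n → iter u n r)
iter-stepCongruent u r m n = eval-respects-∣ u (iter u m r) (iter u n r)

neg-stepCongruent : ∀ a → StepCongruent a → StepCongruent (λ n → - a n)
neg-stepCongruent a a-cong m n with a-cong m n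
... | divides q eq = divides q (begin
  - a (suc m) - - a (suc n)   ≡⟨ negate (a (suc m)) (a (suc n)) ⟩
  - (a (suc m) - a (suc n))   ≡⟨ cong -_ eq ⟩
  - (q * (a m - a n))         ≡⟨ ℤP.neg-distribʳ-* q (a m - a n) ⟩
  q * - (a m - a n)           ≡⟨ cong (q *_) (sym (negate (a m) (a n))) ⟩
  q * (- a m - - a n)         ∎)
  where
  open ≡-Reasoning
  negate : ∀ x y → - x - - y ≡ - (x - y)
  negate = solve-∀

module Periodic {a : ℕ → ℤ} (a-cong : StepCongruent a) {d : ℤ} {j k : ℕ}
                (j≤k : j ≤ k) (recur : d ∣ (a (suc k) - a j)) where

  residue-in-prefix : ∀ n → ∃[ i ] (i ≤ k × d ∣ (a n - a i))
  residue-in-prefix zero = zero , z≤n , divides 0ℤ (trans (ℤP.+-inverseʳ (a 0)) (sym (ℤP.*-zeroˡ d)))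
  residue-in-prefix (suc n) with residue-in-prefix n
  ... | i , i≤k , d∣aₙ-aᵢ with ∣-trans d∣aₙ-aᵢ (a-cong n i) | ℕP.m≤n⇒m<n∨m≡n i≤k
  ...   | d∣aₙ₊₁-aᵢ₊₁ | inj₁ i<k = suc i , i<k , d∣aₙ₊₁-aᵢ₊₁
  ...   | d∣aₙ₊₁-aᵢ₊₁ | inj₂ refl =
    j , j≤k , subst (d ∣_) (chain (a (suc n)) (a (suc k)) (a j)) (∣m∣n⇒∣m+n d∣aₙ₊₁-aᵢ₊₁ recur)
    where
    chain : ∀ x y z → (x - y) + (y - z) ≡ x - z
    chain = solve-∀

  divisor-in-prefix : ∀ {n} → d ∣ a n → ∃[ i ] (i ≤ k × d ∣ a i)
  divisor-in-prefix {n} d∣aₙ with residue-in-prefix n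
  ... | i , i≤k , d∣aₙ-aᵢ = i , i≤k , subst (d ∣_) (cancel (a n) (a i)) (∣m∣n⇒∣m-n d∣aₙ d∣aₙ-aᵢ)
    where
    cancel : ∀ x y → x - (x - y) ≡ y
    cancel = solve-∀

module CountingOrbit {a : ℕ → ℤ} (a-cong : StepCongruent a) (a₀≡1 : a 0 ≡ 1ℤ)
                     (a-hits : ∀ p → Prime p → ∃[ m ] (+ p ∣ a m))
                     (a≢0 : ∀ n → a n ≢ 0ℤ) where

  CountsUpTo : ℕ → Set
  CountsUpTo k = ∀ i → i ≤ k → a i ≡ + suc i

  prime-bound : ∀ {k j p} → CountsUpTo k → j ≤ k → Prime p → + p ∣ (a (suc k) - + suc j) → p ≤ suc k
  prime-bound {k} {j} {p} up j≤k p-prime p∣ =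
    let m , p∣aₘ       = a-hits p p-prime
        i , i≤k , p∣aᵢ = Periodic.divisor-in-prefix {a = a} a-cong j≤k recur p∣aₘ
    in  ℕP.≤-trans (ℕD.∣⇒≤ (∣⇒∣ᵤ (subst (+ p ∣_) (up i i≤k) p∣aᵢ))) (s≤s i≤k)
    where
    recur : + p ∣ (a (suc k) - a j)
    recur = subst (λ x → + p ∣ (a (suc k) - x)) (sym (up j j≤k)) p∣

  -- a k − a (k−m) = m, so a (k+1) ≡ a (k+1−m) = k + 2 − m (mod m).
  next≡k+2-mod : ∀ {k m} → CountsUpTo k → 0 < m → m ≤ k → + m ∣ (a (suc k) - + suc (suc k))
  next≡k+2-mod {k} {suc d} up _ m≤k with ℕP.m≤n⇒∃[o]m+o≡n m≤k
  ... | o , refl = subst (+ suc d ∣_) (shift (a (suc k)) (+ d) (+ o))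
                     (∣m∣n⇒∣m-n m∣aₖ₊₁-aₒ₊₁ (divides 1ℤ (sym (ℤP.*-identityˡ (+ suc d)))))
    where
    gap : ∀ d o → (1ℤ + (1ℤ + (d + o))) - (1ℤ + o) ≡ 1ℤ + d
    gap = solve-∀
    shift : ∀ c d o → (c - (1ℤ + (1ℤ + o))) - (1ℤ + d) ≡ c - (1ℤ + (1ℤ + (1ℤ + (d + o))))
    shift = solve-∀
    o+1≤k : suc o ≤ k
    o+1≤k = s≤s (ℕP.m≤n+m o d)
    m∣aₖ₊₁-aₒ₊₁ : + suc d ∣ (a (suc k) - + suc (suc o))
    m∣aₖ₊₁-aₒ₊₁ = subst₂ (λ x y → x ∣ (a (suc k) - y))
      (trans (cong₂ _-_ (up k ℕP.≤-refl) (up o (ℕP.<⇒≤ o+1≤k))) (gap (+ d) (+ o)))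
      (up (suc o) o+1≤k)
      (a-cong k o)

  next-fresh : ∀ {k j} → CountsUpTo k → j ≤ k → a (suc k) ≢ + suc j
  next-fresh {k} {j} up j≤k aₖ₊₁≡ with prime> (suc k)
  ... | p , p-prime , k+1<p = ℕP.<⇒≱ k+1<p
    (prime-bound up j≤k p-prime (divides 0ℤ (trans (cong (_- + suc j) aₖ₊₁≡) (ℤP.+-inverseʳ (+ suc j)))))

  step-factor : ∀ {k p} → CountsUpTo k → Prime p → + p ∣ (a (suc k) - + suc k) → p ≡ suc k
  step-factor {k} {p} up p-prime p∣ with ℕP.m≤n⇒m<n∨m≡n (prime-bound up ℕP.≤-refl p-prime p∣)
  ... | inj₂ p≡k+1 = p≡k+1
  ... | inj₁ p<k+1 = ⊥-elim (prime∤1 p-prime (subst (+ p ∣_) (unit (a (suc k)) (+ k))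
         (∣m∣n⇒∣m-n p∣ (next≡k+2-mod up (ℕ.>-nonZero⁻¹ p {{prime⇒nonZero p-prime}}) (s≤s⁻¹ p<k+1)))))
    where
    unit : ∀ c k → (c - (1ℤ + k)) - (c - (1ℤ + (1ℤ + k))) ≡ 1ℤ
    unit = solve-∀

  rise-factor : ∀ {k q} → CountsUpTo k → Prime (suc k) → Prime q → + q ∣ (a (suc k) - 1ℤ) → q ≡ suc k
  rise-factor {k} {q} up k+1-prime q-prime q∣ with ℕP.m≤n⇒m<n∨m≡n (prime-bound up z≤n q-prime q∣)
  ... | inj₂ q≡k+1 = q≡k+1
  ... | inj₁ q<k+1 with prime⇒irreducible k+1-prime (∣⇒∣ᵤ q∣k+1)
    where
    rise : ∀ c k → (c - 1ℤ) - (c - (1ℤ + (1ℤ + k))) ≡ 1ℤ + k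
    rise = solve-∀
    q∣k+1 : + q ∣ + suc k
    q∣k+1 = subst (+ q ∣_) (rise (a (suc k)) (+ k))
      (∣m∣n⇒∣m-n q∣ (next≡k+2-mod up (ℕ.>-nonZero⁻¹ q {{prime⇒nonZero q-prime}}) (s≤s⁻¹ q<k+1)))
  ... | inj₁ q≡1 = ⊥-elim (¬prime[1] (subst Prime q≡1 q-prime))
  ... | inj₂ q≡k+1 = q≡k+1

  next-near : ∀ {k c} → CountsUpTo k → a (suc k) ≡ c → 2 ≤ ∣ c - 1ℤ ∣ → 2 ≤ ∣ c - + suc k ∣ → ⊥
  next-near {k} up refl 2≤rise 2≤step with prime-factorℤ 2≤step | prime-factorℤ 2≤rise
  ... | p , p-prime , p∣step | q , q-prime , q∣rise
    with step-factor up p-prime p∣step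
  ... | refl with rise-factor up p-prime q-prime q∣rise
  ... | refl = ℕP.<⇒≱ (ℕP.n<1+n k) (ℕD.∣⇒≤ {{k≢0}} (∣⇒∣ᵤ (subst (+ suc k ∣_) (drop (a (suc k)) (+ k))
                 (∣m∣n⇒∣m-n q∣rise p∣step))))
    where
    drop : ∀ c k → (c - 1ℤ) - (c - (1ℤ + k)) ≡ k
    drop = solve-∀
    k≢0 : ℕ.NonZero k
    k≢0 = ℕ.≢-nonZero λ { refl → ¬prime[1] p-prime }

  next-value : ∀ {k} → CountsUpTo k → a (suc k) ≡ + suc (suc k)
  next-value {k} up with a (suc k) in aₖ₊₁≡
  ... | + zero = ⊥-elim (a≢0 (suc k) aₖ₊₁≡)
  ... | -[1+ n ] = ⊥-elim (next-near up aₖ₊₁≡ (s≤s (s≤s z≤n)) (s≤s (s≤s z≤n)))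
  ... | + suc j with ℕP.<-cmp j (suc k)
  ...   | tri< j<k+1 _ _ = ⊥-elim (next-fresh up (s≤s⁻¹ j<k+1) aₖ₊₁≡)
  ...   | tri≈ _ refl _ = refl
  ...   | tri> _ _ k+1<j with ℕP.m≤n⇒∃[o]m+o≡n k+1<j
  ...     | t , refl = ⊥-elim (next-near up aₖ₊₁≡ (s≤s (s≤s z≤n))
                         (subst (λ x → 2 ≤ ∣ x ∣) (sym (excess (+ k) (+ t))) (s≤s (s≤s z≤n))))
    where
    excess : ∀ k t → (1ℤ + (1ℤ + (1ℤ + (k + t)))) - (1ℤ + k) ≡ 1ℤ + (1ℤ + t)
    excess = solve-∀

  countsUpTo : ∀ k → CountsUpTo k
  countsUpTo zero .zero z≤n = a₀≡1
  countsUpTo (suc k) i i≤k+1 with ℕP.m≤n⇒m<n∨m≡n i≤k+1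
  ... | inj₁ i<k+1 = countsUpTo k i (s≤s⁻¹ i<k+1)
  ... | inj₂ refl = next-value (countsUpTo k)

  counts : ∀ n → a n ≡ + suc n
  counts n = countsUpTo n n ℕP.≤-refl

constTerm : Poly → ℤ
constTerm []      = 0ℤ
constTerm (c ∷ _) = c

shift : Poly → Poly
shift []      = []
shift (_ ∷ u) = u

eval-shift : ∀ u x → eval u x ≡ constTerm u + x * eval (shift u) x
eval-shift []      x = sym (trans (ℤP.+-identityˡ (x * 0ℤ)) (ℤP.*-zeroʳ x))
eval-shift (_ ∷ _) x = refl

coeff-zero : ∀ u → coeff u 0 ≡ constTerm u
coeff-zero []      = refl
coeff-zero (_ ∷ _) = refl

coeff-shift : ∀ u i → coeff u (suc i) ≡ coeff (shift u) i
coeff-shift []      i = refl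
coeff-shift (_ ∷ _) i = refl

divisible-by-unbounded⇒≡0 : ∀ {z} (g : ℕ → ℤ) → (∀ n → n < ∣ g n ∣) → (∀ n → g n ∣ z) → z ≡ 0ℤ
divisible-by-unbounded⇒≡0 {z} g unbounded g∣z with ∣ z ∣ in ∣z∣≡
... | zero  = ℤP.∣i∣≡0⇒i≡0 ∣z∣≡
... | suc m = ⊥-elim (ℕP.<⇒≱ (unbounded (suc m))
  (ℕD.∣⇒≤ (subst (∣ g (suc m) ∣ ℕD.∣_) ∣z∣≡ (∣⇒∣ᵤ (g∣z (suc m))))))

module _ (g : ℕ → ℤ) (unbounded : ∀ n → n < ∣ g n ∣) where

  module _ (u v : Poly) (agree : ∀ n → eval u (g n) ≡ eval v (g n)) where

    private
      split-agree : ∀ n → constTerm u + g n * eval (shift u) (g n) ≡ constTerm v + g n * eval (shift v) (g n)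
      split-agree n = trans (sym (eval-shift u (g n))) (trans (agree n) (eval-shift v (g n)))

    constTerm-agree : constTerm u ≡ constTerm v
    constTerm-agree = ℤP.i-j≡0⇒i≡j _ _ (divisible-by-unbounded⇒≡0 g unbounded λ n →
      divides (eval (shift v) (g n) - eval (shift u) (g n)) (difference n))
      where
      open ≡-Reasoning
      difference : ∀ n → constTerm u - constTerm v ≡ (eval (shift v) (g n) - eval (shift u) (g n)) * g n
      difference n = begin
        cu - cv
          ≡⟨ regroup cu cv x su sv ⟩
        ((cu + x * su) - (cv + x * sv)) + (sv - su) * x
          ≡⟨ cong (λ w → (w - (cv + x * sv)) + (sv - su) * x) (split-agree n) ⟩
        ((cv + x * sv) - (cv + x * sv)) + (sv - su) * x
          ≡⟨ cancel (cv + x * sv) ((sv - su) * x) ⟩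
        (sv - su) * x
          ∎
        where
        cu = constTerm u ; cv = constTerm v ; x = g n
        su = eval (shift u) x ; sv = eval (shift v) x
        regroup : ∀ cu cv x su sv → cu - cv ≡ ((cu + x * su) - (cv + x * sv)) + (sv - su) * x
        regroup = solve-∀
        cancel : ∀ w y → (w - w) + y ≡ y
        cancel = solve-∀

    shift-agree : ∀ n → eval (shift u) (g n) ≡ eval (shift v) (g n)
    shift-agree n = ℤP.*-cancelˡ-≡ x su sv {{ℕ.>-nonZero (ℕP.≤-<-trans z≤n (unbounded n))}} (begin
      x * su                               ≡⟨ add-sub (constTerm u) (x * su) ⟩
      (constTerm u + x * su) - constTerm u ≡⟨ cong₂ _-_ (split-agree n) constTerm-agree ⟩
      (constTerm v + x * sv) - constTerm v ≡⟨ add-sub (constTerm v) (x * sv) ⟨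
      x * sv                               ∎)
      where
      open ≡-Reasoning
      x = g n ; su = eval (shift u) x ; sv = eval (shift v) x
      add-sub : ∀ c y → y ≡ (c + y) - c
      add-sub = solve-∀

  eval-agree⇒≈ₚ : ∀ u v → (∀ n → eval u (g n) ≡ eval v (g n)) → u ≈ₚ v
  eval-agree⇒≈ₚ u v agree zero = trans (coeff-zero u) (trans (constTerm-agree u v agree) (sym (coeff-zero v)))
  eval-agree⇒≈ₚ u v agree (suc i) = trans (coeff-shift u i)
    (trans (eval-agree⇒≈ₚ (shift u) (shift v) (shift-agree u v agree) i) (sym (coeff-shift v i)))

eval-on-orbit : ∀ u r {b : ℕ → ℤ} → (∀ n → iter u n r ≡ b n) → ∀ n → eval u (b n) ≡ b (suc n)
eval-on-orbit u r orbit≡b n = trans (cong (eval u) (sym (orbit≡b n))) (orbit≡b (suc n))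

S⇒hits : ∀ {r u} → S r u → ∀ p → Prime p → ∃[ m ] (+ p ∣ iter u m r)
S⇒hits ((_ , hits) , _) p p-prime with hits p p-prime
... | m , _ , p∣ = m , ∣ᵤ⇒∣ p∣

S⇒iter≢0 : ∀ {r u} → r ≢ 0ℤ → S r u → ∀ n → iter u n r ≢ 0ℤ
S⇒iter≢0 r≢0 _                      zero    = r≢0
S⇒iter≢0 _   ((degree , _) , not-N) (suc n) = λ iter≡0 → not-N (degree , suc n , s≤s z≤n , iter≡0)

counting-orbit⇒S : ∀ u r → coeff u 1 ≡ 1ℤ → (∀ n → ∣ iter u n r ∣ ≡ suc n) → S r u
counting-orbit⇒S u r linear ∣orbit∣ = ((degree , hits) , not-N)
  where
  degree : DegGe1 u
  degree = 1 , s≤s z≤n , λ coeff≡0 → case (trans (sym linear) coeff≡0)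
    where case : 1ℤ ≢ 0ℤ
          case ()
  hits : ∀ p → Prime p → ∃[ m ] (m ℕ.≥ 1 × + p Unsigned.∣ iter u m r)
  hits zero          p-prime = ⊥-elim (¬prime[0] p-prime)
  hits (suc zero)    p-prime = ⊥-elim (¬prime[1] p-prime)
  hits (suc (suc k)) _       = suc k , s≤s z≤n , ℕD.∣-reflexive (sym (∣orbit∣ (suc k)))
  not-N : ¬ N r u
  not-N (_ , n , _ , iter≡0) = ℕP.0≢1+n (trans (sym (cong ∣_∣ iter≡0)) (∣orbit∣ n))

x+1 : Poly
x+1 = 1ℤ ∷ 1ℤ ∷ []

x-1 : Poly
x-1 = -[1+ 0 ] ∷ 1ℤ ∷ []

eval-x+1 : ∀ x → eval x+1 x ≡ 1ℤ + x
eval-x+1 x = linear x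
  where
  linear : ∀ x → 1ℤ + x * (1ℤ + x * 0ℤ) ≡ 1ℤ + x
  linear = solve-∀

eval-x-1 : ∀ x → eval x-1 x ≡ - 1ℤ + x
eval-x-1 x = linear x
  where
  linear : ∀ x → - 1ℤ + x * (1ℤ + x * 0ℤ) ≡ - 1ℤ + x
  linear = solve-∀

iter-x+1 : ∀ n → iter x+1 n 1ℤ ≡ + suc n
iter-x+1 zero    = refl
iter-x+1 (suc n) = trans (cong (eval x+1) (iter-x+1 n)) (eval-x+1 (+ suc n))

iter-x-1 : ∀ n → iter x-1 n -[1+ 0 ] ≡ -[1+ n ]
iter-x-1 zero    = refl
iter-x-1 (suc n) = trans (cong (eval x-1) (iter-x-1 n)) (eval-x-1 -[1+ n ])

x+1∈S₁ : S (+ 1) x+1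
x+1∈S₁ = counting-orbit⇒S x+1 1ℤ refl (λ n → cong ∣_∣ (iter-x+1 n))

x-1∈S₋₁ : S -[1+ 0 ] x-1
x-1∈S₋₁ = counting-orbit⇒S x-1 -[1+ 0 ] refl (λ n → cong ∣_∣ (iter-x-1 n))

S₁-unique : ∀ v → S (+ 1) v → v ≈ₚ x+1
S₁-unique v v∈S = eval-agree⇒≈ₚ (λ n → + suc n) ℕP.n<1+n v x+1 λ n →
  trans (eval-on-orbit v 1ℤ counts n) (sym (eval-x+1 (+ suc n)))
  where open CountingOrbit (iter-stepCongruent v 1ℤ) refl (S⇒hits v∈S) (S⇒iter≢0 (λ ()) v∈S)

-- The orbit of -1 under v is the negated orbit of 1 under x ↦ -v(-x).
S₋₁-unique : ∀ v → S -[1+ 0 ] v → v ≈ₚ x-1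
S₋₁-unique v v∈S = eval-agree⇒≈ₚ (λ n → -[1+ n ]) ℕP.n<1+n v x-1 λ n →
  trans (eval-on-orbit v -[1+ 0 ] iter≡ n) (sym (eval-x-1 -[1+ n ]))
  where
  hits : ∀ p → Prime p → ∃[ m ] (+ p ∣ - iter v m -[1+ 0 ])
  hits p p-prime with S⇒hits v∈S p p-prime
  ... | m , p∣ = m , ∣m⇒∣-m p∣
  nonzero : ∀ n → - iter v n -[1+ 0 ] ≢ 0ℤ
  nonzero n -iter≡0 = S⇒iter≢0 (λ ()) v∈S n (ℤP.neg-injective -iter≡0)
  open CountingOrbit (neg-stepCongruent (λ n → iter v n -[1+ 0 ]) (iter-stepCongruent v -[1+ 0 ])) refl hits nonzero
  iter≡ : ∀ n → iter v n -[1+ 0 ] ≡ -[1+ n ]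
  iter≡ n = trans (sym (ℤP.neg-involutive _)) (cong -_ (counts n))

corollary1 : IsSingleton (S (+ 1)) × IsSingleton (S -[1+ 0 ])
corollary1 = (x+1 , x+1∈S₁ , S₁-unique) , (x-1 , x-1∈S₋₁ , S₋₁-unique)
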